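{- For integers $n\ge 2$ and $m\ge 1$, $\chi_{la}(mC_{2n})=3$.
   Context: $mG$ denotes the disjoint union of $m$ copies of the graph $G$. For a (not necessarily connected) graph $G=(V,E)$ with $q$ edges, a bijection $f:E\to\{1,\ldots,q\}$ is a local antimagic labeling if $f^+(u)\ne f^+(v)$ for all adjacent $u,v$, where $f^+(u)$ is the sum of labels of edges incident to $u$. $\chi_{la}(G)$ is the minimum number of distinct values of $f^+$ over all local antimagic labelings of $G$. -}

module Defs where

open import Data.Nat using (ℕ; zero; suc; _*_; _≤_)
open import Data.Nat.DivMod using (_%_; m%n<n)
open import Data.Fin using (Fin; toℕ; fromℕ<; remQuot; combine; _≟_)
open import Data.Fin.Base using ()
open import Data.List using (List; map; length; deduplicate; allFin)
open import Data.Nat.ListAction using (sum)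
open import Data.Product using (_×_; _,_; proj₁; proj₂; ∃; Σ)
open import Data.Sum using (_⊎_)
open import Data.Bool using (Bool; if_then_else_; _∨_)
open import Relation.Nullary using (does; ¬_)
open import Relation.Binary.PropositionalEquality using (_≡_)
open import Function.Bundles using (Bijection)
import Data.Nat as ℕ

record Graph : Set where
  field
    nV   : ℕ
    nE   : ℕ
    ends : Fin nE → Fin nV × Fin nV
open Graph public

Adjacent : (G : Graph) → Fin (nV G) → Fin (nV G) → Set
Adjacent G u v = ∃ λ e → (ends G e ≡ (u , v)) ⊎ (ends G e ≡ (v , u))

cyc : ∀ {k} → Fin k → Fin k
cyc {suc k} i = fromℕ< (m%n<n (suc (toℕ i)) (suc k))

C : ℕ → Graph
C k = record { nV = k ; nE = k ; ends = λ i → (i , cyc i) }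

copies : ℕ → Graph → Graph
copies m G = record
  { nV = m * nV G
  ; nE = m * nE G
  ; ends = λ e → let ie = remQuot {m} (nE G) e
                     i = proj₁ ie
                     uv = ends G (proj₂ ie)
                 in (combine {m} i (proj₁ uv) , combine {m} i (proj₂ uv)) }

-- A labeling: a bijection E → {1,…,q}, encoded as a bijection Fin q → Fin q, label = 1 + index.
Labeling : Graph → Set
Labeling G = Bijection (Data.Fin.Properties.≡-setoid (nE G)) (Data.Fin.Properties.≡-setoid (nE G))
  where import Data.Fin.Properties

label : (G : Graph) → Labeling G → Fin (nE G) → ℕ
label G f e = suc (toℕ (Bijection.to f e))

incident : (G : Graph) → Fin (nE G) → Fin (nV G) → Bool
incident G e u = does (u ≟ proj₁ (ends G e)) ∨ does (u ≟ proj₂ (ends G e))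

vsum : (G : Graph) → Labeling G → Fin (nV G) → ℕ
vsum G f u = sum (map (λ e → if incident G e u then label G f e else 0) (allFin (nE G)))

IsLocalAntimagic : (G : Graph) → Labeling G → Set
IsLocalAntimagic G f = ∀ u v → Adjacent G u v → ¬ (vsum G f u ≡ vsum G f v)

numColors : (G : Graph) → Labeling G → ℕ
numColors G f = length (deduplicate ℕ._≟_ (map (vsum G f) (allFin (nV G))))

ChiLa≡ : Graph → ℕ → Set
ChiLa≡ G c = (Σ (Labeling G) λ f → IsLocalAntimagic G f × (numColors G f ≡ c))
           × (∀ f → IsLocalAntimagic G f → c ≤ numColors G f)

-- Lower bound: along a copy of C₂ₙ let x₀, x₁, … be the edge labels, so that the vertex sums are
-- sₜ = xₜ₊₁ + xₜ. With at most two colours, (sₜ) is 2-periodic with s₀ ≠ s₁, hence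
-- xₜ₊₂ + s₀ = xₜ + s₁ for even t; going once around the cycle gives n s₀ = n s₁, a contradiction.
-- Upper bound: with M = mn, give edge 2j of copy c the label nc + j + 1 and edge 2j + 1 the label
-- 2M − (nc + j). Then odd vertices have sum 2M + 1, even vertices 2M + 2, except the first vertex
-- of each copy, which has sum 2M + 2 − n ≠ 2M + 1 because n ≥ 2.

{-# OPTIONS --safe #-}
module Submission where

open import Algebra.Properties.CommutativeSemigroup as CommSemigroupProperties using ()
open import Data.Bool using (true; false; if_then_else_; _∨_)
open import Data.Bool.Properties using (∨-zeroʳ)
open import Data.Empty using (⊥-elim)
open import Data.Fin using (Fin; zero; suc; toℕ; fromℕ; inject₁; combine; remQuot; cast; opposite)
  renaming (_≟_ to _≟ᶠ_)
open import Data.Fin.Patterns using (0F; 1F)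
open import Data.Fin.Properties
  using (toℕ-injective; toℕ-fromℕ<; toℕ-fromℕ; toℕ-inject₁; toℕ<n; toℕ-cast; toℕ-combine;
         suc-injective; injective⇒≤; cast-involutive; opposite-involutive; opposite-prop; *↔×;
         remQuot-combine; combine-remQuot; combine-injectiveʳ; combine-surjective)
open import Data.Fin.Relation.Unary.Top using (view; ‵fromℕ; ‵inject₁)
open import Data.List using (List; []; _∷_; map; tabulate; allFin; length; lookup; deduplicate)
open import Data.List.Membership.Propositional using (_∈_)
open import Data.List.Membership.Propositional.Properties
  using (∈-lookup; ∈-map⁺; ∈-map⁻; ∈-allFin; ∈-deduplicate⁺; ∈-deduplicate⁻)
open import Data.List.Properties using (tabulate-cong; map-tabulate)
open import Data.List.Relation.Binary.Subset.Propositional using (_⊆_)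
open import Data.List.Relation.Unary.All as All using ([]; _∷_)
open import Data.List.Relation.Unary.AllPairs using ([]; _∷_)
open import Data.List.Relation.Unary.Any using (here; there; index)
open import Data.List.Relation.Unary.Any.Properties using (lookup-index)
open import Data.List.Relation.Unary.Unique.Propositional using (Unique)
open import Data.List.Relation.Unary.Unique.DecPropositional.Properties using (deduplicate-!)
open import Data.Nat
  using (ℕ; zero; suc; pred; _+_; _*_; _∸_; _≤_; s≤s; z≤n; _≟_; _≤?_;
         NonZero; ≢-nonZero; ≢-nonZero⁻¹)
open import Data.Nat.DivMod using (_%_; _mod_; n%n≡0; m<n⇒m%n≡m; %-distribˡ-+; m%n%n≡m%n)
open import Data.Nat.ListAction using (sum)
open import Data.Nat.Properties
  using (+-identityʳ; +-assoc; +-comm; +-suc; *-comm; *-zeroʳ; *-identityʳ;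
         +-cancelˡ-≡; *-cancelˡ-≡; 1+n≢n; m+1+n≢0; m+n∸n≡m; m∸n+n≡m; ≤-antisym;
         +-commutativeSemigroup; *-commutativeSemigroup)
open import Data.Nat.Tactic.RingSolver using (solve-∀)
open import Data.Product using (_×_; _,_; proj₁; proj₂; map₂; uncurry)
open import Data.Product.Algebra using (×-comm; ×-assoc)
open import Data.Product.Function.NonDependent.Propositional using (_×-↔_)
open import Data.Sum using (_⊎_; inj₁; inj₂)
open import Function using (_∘_)
open import Function.Bundles using (_↔_; Inverse; mk↔ₛ′)
open import Function.Properties.Inverse using (↔-trans; ↔-refl; ↔-sym; ↔⇒⤖)
open import Function.Related.Propositional using (module EquationalReasoning)
open import Level using (0ℓ)
open import Relation.Binary.PropositionalEquality
open import Relation.Nullary using (¬_; yes; no; does)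
open import Relation.Nullary.Decidable using (dec-true; dec-false; decidable-stable)

open import Defs

open CommSemigroupProperties +-commutativeSemigroup using ()
  renaming (interchange to +-interchange; x∙yz≈y∙xz to +-leftSwap)
open CommSemigroupProperties *-commutativeSemigroup using ()
  renaming (x∙yz≈y∙xz to *-leftSwap)

cast↔ : ∀ {a b} → a ≡ b → Fin a ↔ Fin b
cast↔ eq = mk↔ₛ′ (cast eq) (cast (sym eq)) (cast-involutive eq (sym eq)) (cast-involutive (sym eq) eq)

parity↔ : ∀ {n} → Fin (2 * n) ↔ (Fin n × Fin 2)
parity↔ {n} = ↔-trans (cast↔ (*-comm 2 n)) *↔×

reflectOdd : ∀ {M} → Fin 2 × Fin M → Fin 2 × Fin M
reflectOdd (zero  , y) = zero , y
reflectOdd (suc b , y) = suc b , opposite y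

reflectOdd-involutive : ∀ {M} (x : Fin 2 × Fin M) → reflectOdd (reflectOdd x) ≡ x
reflectOdd-involutive (zero  , y) = refl
reflectOdd-involutive (suc b , y) = cong (suc b ,_) (opposite-involutive y)

reflectOdd↔ : ∀ {M} → (Fin 2 × Fin M) ↔ (Fin 2 × Fin M)
reflectOdd↔ = mk↔ₛ′ reflectOdd reflectOdd reflectOdd-involutive reflectOdd-involutive

coordinates↔ : ∀ {m n} → Fin (m * (2 * n)) ↔ (Fin m × (Fin n × Fin 2))
coordinates↔ = ↔-trans *↔× (↔-refl ×-↔ parity↔)

rank↔ : ∀ {m n} → (Fin m × (Fin n × Fin 2)) ↔ Fin (m * (2 * n))
rank↔ {m} {n} = begin
  (Fin m × (Fin n × Fin 2))  ↔⟨ ×-assoc 0ℓ _ _ _ ⟨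
  ((Fin m × Fin n) × Fin 2)  ↔⟨ ↔-sym *↔× ×-↔ ↔-refl ⟩
  (Fin (m * n) × Fin 2)      ↔⟨ ×-comm _ _ ⟩
  (Fin 2 × Fin (m * n))      ↔⟨ reflectOdd↔ ⟩
  (Fin 2 × Fin (m * n))      ↔⟨ *↔× ⟨
  Fin (2 * (m * n))          ↔⟨ cast↔ (*-leftSwap 2 m n) ⟩
  Fin (m * (2 * n))          ∎
  where open EquationalReasoning

pos : ∀ {n} → Fin n → Fin 2 → Fin (2 * n)
pos j b = Inverse.from parity↔ (j , b)

open ≡-Reasoning

coordinates-elim : ∀ {m n} (P : Fin (m * (2 * n)) → Set) → (∀ c j b → P (combine c (pos j b))) → ∀ u → P u
coordinates-elim {m} {n} P P-pos u =
  subst P (Inverse.strictlyInverseʳ (coordinates↔ {m} {n}) u) (P-pos c (proj₁ jb) (proj₂ jb))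
  where
  c : Fin m
  c = proj₁ (Inverse.to (coordinates↔ {m} {n}) u)
  jb : Fin n × Fin 2
  jb = proj₂ (Inverse.to (coordinates↔ {m} {n}) u)

toℕ-pos : ∀ {n} (j : Fin n) b → toℕ (pos j b) ≡ 2 * toℕ j + toℕ b
toℕ-pos j b = trans (toℕ-cast _ (combine j b)) (toℕ-combine j b)

toℕ-opposite+suc : ∀ {M} (y : Fin M) → toℕ (opposite y) + suc (toℕ y) ≡ M
toℕ-opposite+suc y = trans (cong (_+ suc (toℕ y)) (opposite-prop y)) (m∸n+n≡m (toℕ<n y))

toℕ-combine-suc : ∀ {m n} (c : Fin m) (j : Fin n) → toℕ (combine c (suc j)) ≡ suc (toℕ (combine c (inject₁ j)))
toℕ-combine-suc {n = n} c j = begin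
  toℕ (combine c (suc j))                ≡⟨ toℕ-combine c (suc j) ⟩
  suc n * toℕ c + suc (toℕ j)            ≡⟨ +-suc _ (toℕ j) ⟩
  suc (suc n * toℕ c + toℕ j)            ≡⟨ cong (λ t → suc (suc n * toℕ c + t)) (toℕ-inject₁ j) ⟨
  suc (suc n * toℕ c + toℕ (inject₁ j))  ≡⟨ cong suc (toℕ-combine c (inject₁ j)) ⟨
  suc (toℕ (combine c (inject₁ j)))      ∎

cyc-last : ∀ {k} {i : Fin (suc k)} → toℕ i ≡ k → cyc i ≡ zero
cyc-last {k} {i} i≡k = toℕ-injective (begin
  toℕ (cyc i)          ≡⟨ toℕ-fromℕ< _ ⟩
  suc (toℕ i) % suc k  ≡⟨ cong (λ t → suc t % suc k) i≡k ⟩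
  suc k % suc k        ≡⟨ n%n≡0 (suc k) ⟩
  0                    ∎)

cyc-toℕ : ∀ {k} {i j : Fin (suc k)} → suc (toℕ i) ≡ toℕ j → cyc i ≡ j
cyc-toℕ {k} {i} {j} i+1≡j = toℕ-injective (begin
  toℕ (cyc i)          ≡⟨ toℕ-fromℕ< _ ⟩
  suc (toℕ i) % suc k  ≡⟨ cong (_% suc k) i+1≡j ⟩
  toℕ j % suc k        ≡⟨ m<n⇒m%n≡m (toℕ<n j) ⟩
  toℕ j                ∎)

cyc-inject₁ : ∀ {k} (i : Fin k) → cyc (inject₁ i) ≡ suc i
cyc-inject₁ i = cyc-toℕ (cong suc (toℕ-inject₁ i))

cyc-mod : ∀ {k} t → cyc (t mod suc k) ≡ suc t mod suc k
cyc-mod {k} t = toℕ-injective (begin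
  toℕ (cyc (t mod N))        ≡⟨ toℕ-fromℕ< _ ⟩
  suc (toℕ (t mod N)) % N    ≡⟨ cong (λ r → suc r % N) (toℕ-fromℕ< _) ⟩
  (1 + t % N) % N            ≡⟨ %-distribˡ-+ 1 (t % N) N ⟩
  (1 % N + t % N % N) % N    ≡⟨ cong (λ r → (1 % N + r) % N) (m%n%n≡m%n t N) ⟩
  (1 % N + t % N) % N        ≡⟨ %-distribˡ-+ 1 t N ⟨
  suc t % N                  ≡⟨ toℕ-fromℕ< _ ⟨
  toℕ (suc t mod N)          ∎)
  where N = suc k

mod-self : ∀ k → suc k mod suc k ≡ zero
mod-self k = toℕ-injective (trans (toℕ-fromℕ< _) (n%n≡0 (suc k)))

cyc⁻¹ : ∀ {k} → Fin (suc k) → Fin (suc k)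
cyc⁻¹ {k} zero = fromℕ k
cyc⁻¹ (suc i)  = inject₁ i

cyc-cyc⁻¹ : ∀ {k} (i : Fin (suc k)) → cyc (cyc⁻¹ i) ≡ i
cyc-cyc⁻¹ {k} zero = cyc-last (toℕ-fromℕ k)
cyc-cyc⁻¹ (suc i)  = cyc-inject₁ i

cyc⁻¹-cyc : ∀ {k} (i : Fin (suc k)) → cyc⁻¹ (cyc i) ≡ i
cyc⁻¹-cyc {k} i with view i
... | ‵fromℕ     = cong cyc⁻¹ (cyc-last (toℕ-fromℕ k))
... | ‵inject₁ j = cong cyc⁻¹ (cyc-inject₁ j)

cyc⁻¹-≢ : ∀ {k} .{{_ : NonZero k}} (i : Fin (suc k)) → cyc⁻¹ i ≢ i
cyc⁻¹-≢ {suc k} zero ()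
cyc⁻¹-≢ (suc i) eq = 1+n≢n (sym (trans (sym (toℕ-inject₁ i)) (cong toℕ eq)))

sum-tabulate-+ : ∀ {N} (f g : Fin N → ℕ) →
                 sum (tabulate (λ i → f i + g i)) ≡ sum (tabulate f) + sum (tabulate g)
sum-tabulate-+ {zero}  f g = refl
sum-tabulate-+ {suc N} f g = begin
  (f zero + g zero) + sum (tabulate (λ i → f (suc i) + g (suc i)))
    ≡⟨ cong (f zero + g zero +_) (sum-tabulate-+ (f ∘ suc) (g ∘ suc)) ⟩
  (f zero + g zero) + (sum (tabulate (f ∘ suc)) + sum (tabulate (g ∘ suc)))
    ≡⟨ +-interchange (f zero) (g zero) _ _ ⟩
  (f zero + sum (tabulate (f ∘ suc))) + (g zero + sum (tabulate (g ∘ suc))) ∎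

sum-tabulate-zero : ∀ {N} (f : Fin N → ℕ) → (∀ i → f i ≡ 0) → sum (tabulate f) ≡ 0
sum-tabulate-zero {zero}  f f≡0 = refl
sum-tabulate-zero {suc N} f f≡0 =
  cong₂ _+_ (f≡0 zero) (sum-tabulate-zero (f ∘ suc) (f≡0 ∘ suc))

sum-tabulate-single : ∀ {N} (f : Fin N → ℕ) (a : Fin N) → (∀ i → i ≢ a → f i ≡ 0) →
                      sum (tabulate f) ≡ f a
sum-tabulate-single f zero f≡0 = begin
  f zero + sum (tabulate (f ∘ suc))  ≡⟨ cong (f zero +_) (sum-tabulate-zero (f ∘ suc) (λ i → f≡0 (suc i) λ ())) ⟩
  f zero + 0                         ≡⟨ +-identityʳ (f zero) ⟩
  f zero                             ∎
sum-tabulate-single f (suc a) f≡0 =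
  cong₂ _+_ (f≡0 zero λ ()) (sum-tabulate-single (f ∘ suc) a (λ i i≢a → f≡0 (suc i) (i≢a ∘ suc-injective)))

sum-tabulate-pair : ∀ {N} (f : Fin N → ℕ) {a b : Fin N} → a ≢ b → (∀ i → i ≢ a → i ≢ b → f i ≡ 0) →
                    sum (tabulate f) ≡ f a + f b
sum-tabulate-pair f {a} {b} a≢b f≡0 = begin
  sum (tabulate f)                         ≡⟨ cong sum (tabulate-cong split) ⟩
  sum (tabulate (λ i → at-a i + off-a i))  ≡⟨ sum-tabulate-+ at-a off-a ⟩
  sum (tabulate at-a) + sum (tabulate off-a)
    ≡⟨ cong₂ _+_ (sum-tabulate-single at-a a at-a-single) (sum-tabulate-single off-a b off-a-single) ⟩
  at-a a + off-a b                         ≡⟨ cong₂ _+_ at-a-a off-a-b ⟩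
  f a + f b                                ∎
  where
  at-a off-a : Fin _ → ℕ
  at-a  i = if does (i ≟ᶠ a) then f i else 0
  off-a i = if does (i ≟ᶠ a) then 0 else f i

  split : ∀ i → f i ≡ at-a i + off-a i
  split i with i ≟ᶠ a
  ... | yes _ = sym (+-identityʳ (f i))
  ... | no  _ = refl

  at-a-single : ∀ i → i ≢ a → at-a i ≡ 0
  at-a-single i i≢a rewrite dec-false (i ≟ᶠ a) i≢a = refl

  off-a-single : ∀ i → i ≢ b → off-a i ≡ 0
  off-a-single i i≢b with i ≟ᶠ a
  ... | yes _   = refl
  ... | no  i≢a = f≡0 i i≢a i≢b

  at-a-a : at-a a ≡ f a
  at-a-a rewrite dec-true (a ≟ᶠ a) refl = refl

  off-a-b : off-a b ≡ f b
  off-a-b rewrite dec-false (b ≟ᶠ a) (a≢b ∘ sym) = refl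

Unique⇒lookup-injective : ∀ {A : Set} {xs : List A} → Unique xs → ∀ {i j} → lookup xs i ≡ lookup xs j → i ≡ j
Unique⇒lookup-injective (_ ∷ _)   {zero}  {zero}  _  = refl
Unique⇒lookup-injective (x≢ ∷ _)  {zero}  {suc j} eq = ⊥-elim (All.lookup x≢ (∈-lookup j) eq)
Unique⇒lookup-injective (x≢ ∷ _)  {suc i} {zero}  eq = ⊥-elim (All.lookup x≢ (∈-lookup i) (sym eq))
Unique⇒lookup-injective (_ ∷ xs!) {suc i} {suc j} eq = cong suc (Unique⇒lookup-injective xs! eq)

Unique⊆⇒length≤ : ∀ {A : Set} {xs ys : List A} → Unique xs → xs ⊆ ys → length xs ≤ length ys
Unique⊆⇒length≤ {xs = xs} {ys} xs! xs⊆ys = injective⇒≤ {f = position} position-injective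
  where
  position : Fin (length xs) → Fin (length ys)
  position i = index (xs⊆ys (∈-lookup i))

  position-injective : ∀ {i j} → position i ≡ position j → i ≡ j
  position-injective {i} {j} eq = Unique⇒lookup-injective xs! (begin
    lookup xs i           ≡⟨ lookup-index (xs⊆ys (∈-lookup i)) ⟩
    lookup ys (position i) ≡⟨ cong (lookup ys) eq ⟩
    lookup ys (position j) ≡⟨ lookup-index (xs⊆ys (∈-lookup j)) ⟨
    lookup xs j           ∎)

colours : (G : Graph) → Labeling G → List ℕ
colours G f = deduplicate _≟_ (map (vsum G f) (allFin (nV G)))

vsum∈colours : ∀ G f u → vsum G f u ∈ colours G f
vsum∈colours G f u = ∈-deduplicate⁺ _≟_ (∈-map⁺ (vsum G f) (∈-allFin u))

numColors≤ : ∀ G f {cs : List ℕ} → (∀ u → vsum G f u ∈ cs) → numColors G f ≤ length cs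
numColors≤ G f covered = Unique⊆⇒length≤ (deduplicate-! _≟_ _) colours⊆
  where
  colours⊆ : colours G f ⊆ _
  colours⊆ s∈ with ∈-map⁻ (vsum G f) (∈-deduplicate⁻ _≟_ _ s∈)
  ... | u , _ , refl = covered u

3≤numColors : ∀ G f {u v w} → vsum G f u ≢ vsum G f v → vsum G f u ≢ vsum G f w →
              vsum G f v ≢ vsum G f w → 3 ≤ numColors G f
3≤numColors G f {u} {v} {w} u≢v u≢w v≢w =
  Unique⊆⇒length≤ ((u≢v ∷ u≢w ∷ []) ∷ (v≢w ∷ []) ∷ [] ∷ []) ⊆colours
  where
  ⊆colours : (vsum G f u ∷ vsum G f v ∷ vsum G f w ∷ []) ⊆ colours G f
  ⊆colours (here refl)                 = vsum∈colours G f u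
  ⊆colours (there (here refl))         = vsum∈colours G f v
  ⊆colours (there (there (here refl))) = vsum∈colours G f w

module CycleCopies (m k : ℕ) where

  G : Graph
  G = copies m (C (suc k))

  next prev : Fin (m * suc k) → Fin (m * suc k)
  next e = uncurry combine (map₂ cyc   (remQuot {m} (suc k) e))
  prev e = uncurry combine (map₂ cyc⁻¹ (remQuot {m} (suc k) e))

  next-combine : ∀ c p → next (combine c p) ≡ combine c (cyc p)
  next-combine c p = cong (uncurry combine ∘ map₂ cyc) (remQuot-combine {m} {suc k} c p)

  prev-combine : ∀ c p → prev (combine c p) ≡ combine c (cyc⁻¹ p)
  prev-combine c p = cong (uncurry combine ∘ map₂ cyc⁻¹) (remQuot-combine {m} {suc k} c p)

  prev-combine-cyc : ∀ {c : Fin m} {p q : Fin (suc k)} → cyc p ≡ q → prev (combine c q) ≡ combine c p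
  prev-combine-cyc {c} {p} refl = trans (prev-combine c (cyc p)) (cong (combine c) (cyc⁻¹-cyc p))

  prev-next : ∀ e → prev (next e) ≡ e
  prev-next e with combine-surjective {m} e
  ... | c , p , refl = trans (cong prev (next-combine c p)) (prev-combine-cyc refl)

  next-prev : ∀ e → next (prev e) ≡ e
  next-prev e with combine-surjective {m} e
  ... | c , p , refl = begin
    next (prev (combine c p))      ≡⟨ cong next (prev-combine c p) ⟩
    next (combine c (cyc⁻¹ p))     ≡⟨ next-combine c (cyc⁻¹ p) ⟩
    combine c (cyc (cyc⁻¹ p))      ≡⟨ cong (combine c) (cyc-cyc⁻¹ p) ⟩
    combine c p                    ∎

  prev-≢ : .{{_ : NonZero k}} → ∀ e → prev e ≢ e
  prev-≢ e with combine-surjective {m} e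
  ... | c , p , refl = λ eq →
    cyc⁻¹-≢ p (combine-injectiveʳ c (cyc⁻¹ p) c p (trans (sym (prev-combine c p)) eq))

  ends-copies : ∀ e → ends G e ≡ (e , next e)
  ends-copies e = cong (_, next e) (combine-remQuot {m} (suc k) e)

  incident-copies : ∀ e u → incident G e u ≡ does (u ≟ᶠ e) ∨ does (u ≟ᶠ next e)
  incident-copies e u = cong (λ (v , w) → does (u ≟ᶠ v) ∨ does (u ≟ᶠ w)) (ends-copies e)

  incident-self : ∀ u → incident G u u ≡ true
  incident-self u rewrite incident-copies u u | dec-true (u ≟ᶠ u) refl = refl

  incident-prev : ∀ u → incident G (prev u) u ≡ true
  incident-prev u rewrite incident-copies (prev u) u | dec-true (u ≟ᶠ next (prev u)) (sym (next-prev u)) =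
    ∨-zeroʳ _

  incident⇒ : ∀ e u → incident G e u ≡ true → e ≡ u ⊎ e ≡ prev u
  incident⇒ e u inc rewrite incident-copies e u with u ≟ᶠ e | u ≟ᶠ next e
  ... | yes u≡e | _        = inj₁ (sym u≡e)
  ... | no _    | yes u≡ne = inj₂ (trans (sym (prev-next e)) (cong prev (sym u≡ne)))
  ... | no _    | no _     with () ← inc

  vsum-copies : .{{_ : NonZero k}} → ∀ f u → vsum G f u ≡ label G f u + label G f (prev u)
  vsum-copies f u = begin
    vsum G f u                 ≡⟨ cong sum (map-tabulate (λ e → e) at-u) ⟩
    sum (tabulate at-u)        ≡⟨ sum-tabulate-pair at-u (λ u≡p → prev-≢ u (sym u≡p)) off-u ⟩
    at-u u + at-u (prev u)     ≡⟨ cong₂ _+_ (on-u (incident-self u)) (on-u (incident-prev u)) ⟩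
    label G f u + label G f (prev u) ∎
    where
    at-u : Fin (m * suc k) → ℕ
    at-u e = if incident G e u then label G f e else 0

    on-u : ∀ {e} → incident G e u ≡ true → at-u e ≡ label G f e
    on-u inc rewrite inc = refl

    off-u : ∀ e → e ≢ u → e ≢ prev u → at-u e ≡ 0
    off-u e e≢u e≢p with incident G e u in inc
    ... | false = refl
    ... | true  with incident⇒ e u inc
    ...   | inj₁ e≡u = ⊥-elim (e≢u e≡u)
    ...   | inj₂ e≡p = ⊥-elim (e≢p e≡p)

  adjacent-next : ∀ u → Adjacent G u (next u)
  adjacent-next u = u , inj₁ (ends-copies u)

  ends⇒prev : ∀ {e u v} → ends G e ≡ (u , v) → u ≡ prev v
  ends⇒prev {e} ends≡ with trans (sym (ends-copies e)) ends≡
  ... | refl = sym (prev-next e)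

  adjacent⇒prev : ∀ {u v} → Adjacent G u v → u ≡ prev v ⊎ v ≡ prev u
  adjacent⇒prev (_ , inj₁ ends≡) = inj₁ (ends⇒prev ends≡)
  adjacent⇒prev (_ , inj₂ ends≡) = inj₂ (ends⇒prev ends≡)

  antimagic-from-prev : ∀ f → (∀ v → vsum G f (prev v) ≢ vsum G f v) → IsLocalAntimagic G f
  antimagic-from-prev f prev≢ u v adj with adjacent⇒prev adj
  ... | inj₁ refl = prev≢ v
  ... | inj₂ refl = prev≢ u ∘ sym

instance
  even-cycle-nonTrivial : ∀ {n} → NonZero (pred (2 * suc n))
  even-cycle-nonTrivial {n} = ≢-nonZero (m+1+n≢0 n)

two-periodic-sums⇒constant : (x s : ℕ → ℕ) (n : ℕ) .{{_ : NonZero n}} →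
  (∀ t → s t ≡ x (suc t) + x t) → (∀ t → s (2 + t) ≡ s t) → x (2 * n) ≡ x 0 → s 0 ≡ s 1
two-periodic-sums⇒constant x s n s≡ s-periodic closed =
  *-cancelˡ-≡ (s 0) (s 1) n (+-cancelˡ-≡ (x 0) _ _ (begin
    x 0 + n * s 0        ≡⟨ cong (_+ n * s 0) closed' ⟨
    x (n * 2) + n * s 0  ≡⟨ telescope n ⟩
    x 0 + n * s 1        ∎))
  where
  closed' : x (n * 2) ≡ x 0
  closed' = trans (cong x (*-comm n 2)) closed

  s-even : ∀ t → s (t * 2) ≡ s 0
  s-even zero    = refl
  s-even (suc t) = trans (s-periodic (t * 2)) (s-even t)

  s-odd : ∀ t → s (suc (t * 2)) ≡ s 1
  s-odd zero    = refl
  s-odd (suc t) = trans (s-periodic (suc (t * 2))) (s-odd t)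

  step : ∀ u → x (2 + u) + s u ≡ s (1 + u) + x u
  step u = begin
    x (2 + u) + s u                ≡⟨ cong (x (2 + u) +_) (s≡ u) ⟩
    x (2 + u) + (x (1 + u) + x u)  ≡⟨ +-assoc (x (2 + u)) (x (1 + u)) (x u) ⟨
    (x (2 + u) + x (1 + u)) + x u  ≡⟨ cong (_+ x u) (s≡ (1 + u)) ⟨
    s (1 + u) + x u                ∎

  telescope : ∀ t → x (t * 2) + t * s 0 ≡ x 0 + t * s 1
  telescope zero    = refl
  telescope (suc t) = begin
    x (2 + t * 2) + (s 0 + t * s 0)          ≡⟨ +-assoc (x (2 + t * 2)) (s 0) (t * s 0) ⟨
    (x (2 + t * 2) + s 0) + t * s 0          ≡⟨ cong (λ r → x (2 + t * 2) + r + t * s 0) (s-even t) ⟨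
    (x (2 + t * 2) + s (t * 2)) + t * s 0    ≡⟨ cong (_+ t * s 0) (step (t * 2)) ⟩
    (s (1 + t * 2) + x (t * 2)) + t * s 0    ≡⟨ +-assoc (s (1 + t * 2)) (x (t * 2)) (t * s 0) ⟩
    s (1 + t * 2) + (x (t * 2) + t * s 0)    ≡⟨ cong₂ _+_ (s-odd t) (telescope t) ⟩
    s 1 + (x 0 + t * s 1)                    ≡⟨ +-leftSwap (s 1) (x 0) (t * s 1) ⟩
    x 0 + (s 1 + t * s 1)                    ∎

module _ {m n : ℕ} (c : Fin m) where
  open CycleCopies m (pred (2 * suc n))

  walk : ℕ → Fin (m * (2 * suc n))
  walk t = combine c (t mod (2 * suc n))

  next-walk : ∀ t → next (walk t) ≡ walk (suc t)
  next-walk t = trans (next-combine c _) (cong (combine c) (cyc-mod t))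

  prev-walk : ∀ t → prev (walk (suc t)) ≡ walk t
  prev-walk t = trans (cong prev (sym (next-walk t))) (prev-next (walk t))

  adjacent-walk : ∀ t → Adjacent G (walk t) (walk (suc t))
  adjacent-walk t = subst (Adjacent G (walk t)) (next-walk t) (adjacent-next (walk t))

  antimagic⇒3≤numColors : ∀ f → IsLocalAntimagic G f → 3 ≤ numColors G f
  -- 3 ≤ numColors G f is decidable, so we may assume at most two colours and derive s 0 ≡ s 1.
  antimagic⇒3≤numColors f anti = decidable-stable (3 ≤? numColors G f) λ 3≰ →
    anti (walk 1) (walk 2) (adjacent-walk 1)
      (two-periodic-sums⇒constant x s (suc n) s≡ (s-periodic 3≰) (cong (label G f) walk-closed))
    where
    x s : ℕ → ℕ
    x t = label G f (walk t)
    s t = vsum G f (walk (suc t))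

    s≡ : ∀ t → s t ≡ x (suc t) + x t
    s≡ t = trans (vsum-copies f (walk (suc t))) (cong (λ e → x (suc t) + label G f e) (prev-walk t))

    walk-closed : walk (2 * suc n) ≡ walk 0
    walk-closed = cong (combine c) (mod-self _)

    s≢s-suc : ∀ t → s t ≢ s (suc t)
    s≢s-suc t = anti (walk (suc t)) (walk (2 + t)) (adjacent-walk (suc t))

    s-periodic : ¬ 3 ≤ numColors G f → ∀ t → s (2 + t) ≡ s t
    s-periodic 3≰ t = decidable-stable (s (2 + t) ≟ s t) λ s≢ →
      3≰ (3≤numColors G f {walk (1 + t)} {walk (2 + t)} {walk (3 + t)} (s≢s-suc t) (s≢ ∘ sym) (s≢s-suc (suc t)))

module EvenCycleLabelling (m n′ : ℕ) where
  private
    n M : ℕ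
    n = suc n′
    M = m * n
  open CycleCopies m (pred (2 * n))

  labelling : Labeling G
  labelling = ↔⇒⤖ (↔-trans (coordinates↔ {m} {n}) (rank↔ {m} {n}))

  L : Fin (m * (2 * n)) → ℕ
  L = label G labelling

  label-combine : ∀ c j b → L (combine c (pos j b)) ≡ suc (toℕ (uncurry combine (reflectOdd (b , combine c j))))
  label-combine c j b = cong suc (begin
    toℕ (Inverse.to (rank↔ {m} {n}) (Inverse.to (coordinates↔ {m} {n}) (combine c (pos j b))))
      ≡⟨ cong (toℕ ∘ Inverse.to (rank↔ {m} {n})) (Inverse.strictlyInverseˡ (coordinates↔ {m} {n}) (c , j , b)) ⟩
    toℕ (Inverse.to (rank↔ {m} {n}) (c , j , b))
      ≡⟨ toℕ-cast _ _ ⟩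
    toℕ (uncurry combine (reflectOdd (b , combine c j))) ∎)

  label-even : ∀ c j → L (combine c (pos j 0F)) ≡ suc (toℕ (combine c j))
  label-even c j = begin
    L (combine c (pos j 0F))          ≡⟨ label-combine c j 0F ⟩
    suc (toℕ (combine {2} {M} 0F y))  ≡⟨ cong suc (toℕ-combine {2} {M} 0F y) ⟩
    suc (M * 0 + toℕ y)               ≡⟨ cong (λ r → suc (r + toℕ y)) (*-zeroʳ M) ⟩
    suc (toℕ y)                       ∎
    where
    y : Fin M
    y = combine c j

  label-odd : ∀ c j → L (combine c (pos j 1F)) + toℕ (combine c j) ≡ 2 * M
  label-odd c j = begin
    L (combine c (pos j 1F)) + toℕ y
      ≡⟨ cong (_+ toℕ y) (label-combine c j 1F) ⟩
    suc (toℕ (combine {2} {M} 1F (opposite y))) + toℕ y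
      ≡⟨ cong (λ r → suc r + toℕ y) (toℕ-combine {2} {M} 1F (opposite y)) ⟩
    suc (M * 1 + toℕ (opposite y)) + toℕ y    ≡⟨ +-suc _ (toℕ y) ⟨
    (M * 1 + toℕ (opposite y)) + suc (toℕ y)  ≡⟨ +-assoc (M * 1) _ _ ⟩
    M * 1 + (toℕ (opposite y) + suc (toℕ y))  ≡⟨ cong₂ _+_ (*-identityʳ M) (toℕ-opposite+suc y) ⟩
    M + M                                     ≡⟨ cong (M +_) (+-identityʳ M) ⟨
    2 * M                                     ∎
    where
    y : Fin M
    y = combine c j

  cyc-pos-even : ∀ (j : Fin n) → cyc (pos j 0F) ≡ pos j 1F
  cyc-pos-even j = cyc-toℕ (begin
    suc (toℕ (pos j 0F))   ≡⟨ cong suc (toℕ-pos j 0F) ⟩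
    suc (2 * toℕ j + 0)    ≡⟨ +-suc (2 * toℕ j) 0 ⟨
    2 * toℕ j + 1          ≡⟨ toℕ-pos j 1F ⟨
    toℕ (pos j 1F)         ∎)

  cyc-pos-odd : ∀ (j : Fin n′) → cyc (pos (inject₁ j) 1F) ≡ pos (suc j) 0F
  cyc-pos-odd j = cyc-toℕ (begin
    suc (toℕ (pos (inject₁ j) 1F))      ≡⟨ cong suc (toℕ-pos (inject₁ j) 1F) ⟩
    suc (2 * toℕ (inject₁ j) + 1)       ≡⟨ cong (λ t → suc (2 * t + 1)) (toℕ-inject₁ j) ⟩
    suc (2 * toℕ j + 1)                 ≡⟨ arith (toℕ j) ⟩
    2 * suc (toℕ j) + 0                 ≡⟨ toℕ-pos (suc j) 0F ⟨
    toℕ (pos (suc j) 0F)                ∎)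
    where
    arith : ∀ a → suc (2 * a + 1) ≡ 2 * suc a + 0
    arith = solve-∀

  cyc-pos-last : cyc (pos (fromℕ n′) 1F) ≡ pos 0F 0F
  cyc-pos-last = trans (cyc-last last) (sym (toℕ-injective (toℕ-pos {n} 0F 0F)))
    where
    arith : ∀ a → 2 * a + 1 ≡ a + suc (a + 0)
    arith = solve-∀

    last : toℕ (pos (fromℕ n′) 1F) ≡ n′ + suc (n′ + 0)
    last = begin
      toℕ (pos (fromℕ n′) 1F)   ≡⟨ toℕ-pos (fromℕ n′) 1F ⟩
      2 * toℕ (fromℕ n′) + 1    ≡⟨ cong (λ t → 2 * t + 1) (toℕ-fromℕ n′) ⟩
      2 * n′ + 1                ≡⟨ arith n′ ⟩
      n′ + suc (n′ + 0)         ∎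

  prev-odd : ∀ (c : Fin m) (j : Fin n) → prev (combine c (pos j 1F)) ≡ combine c (pos j 0F)
  prev-odd c j = prev-combine-cyc (cyc-pos-even j)

  prev-even : ∀ (c : Fin m) (j : Fin n′) → prev (combine c (pos (suc j) 0F)) ≡ combine c (pos (inject₁ j) 1F)
  prev-even c j = prev-combine-cyc (cyc-pos-odd j)

  prev-first : ∀ (c : Fin m) → prev (combine c (pos 0F 0F)) ≡ combine c (pos (fromℕ n′) 1F)
  prev-first c = prev-combine-cyc cyc-pos-last

  vsum-odd : ∀ (c : Fin m) (j : Fin n) → vsum G labelling (combine c (pos j 1F)) ≡ suc (2 * M)
  vsum-odd c j = begin
    vsum G labelling (combine c (pos j 1F))          ≡⟨ vsum-copies labelling _ ⟩
    L (combine c (pos j 1F)) + L (prev (combine c (pos j 1F)))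
      ≡⟨ cong (λ e → L (combine c (pos j 1F)) + L e) (prev-odd c j) ⟩
    L (combine c (pos j 1F)) + L (combine c (pos j 0F))
      ≡⟨ cong (L (combine c (pos j 1F)) +_) (label-even c j) ⟩
    L (combine c (pos j 1F)) + suc (toℕ (combine c j))  ≡⟨ +-suc (L (combine c (pos j 1F))) _ ⟩
    suc (L (combine c (pos j 1F)) + toℕ (combine c j))  ≡⟨ cong suc (label-odd c j) ⟩
    suc (2 * M)                                        ∎

  vsum-even : ∀ (c : Fin m) (j : Fin n′) → vsum G labelling (combine c (pos (suc j) 0F)) ≡ 2 + 2 * M
  vsum-even c j = begin
    vsum G labelling (combine c (pos (suc j) 0F))    ≡⟨ vsum-copies labelling _ ⟩
    L (combine c (pos (suc j) 0F)) + L (prev (combine c (pos (suc j) 0F)))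
      ≡⟨ cong₂ _+_ (label-even c (suc j)) (cong L (prev-even c j)) ⟩
    suc (toℕ (combine c (suc j))) + L (combine c (pos (inject₁ j) 1F))
      ≡⟨ cong (λ t → suc t + L (combine c (pos (inject₁ j) 1F))) (toℕ-combine-suc c j) ⟩
    2 + (toℕ (combine c (inject₁ j)) + L (combine c (pos (inject₁ j) 1F)))
      ≡⟨ cong (2 +_) (+-comm (toℕ (combine c (inject₁ j))) _) ⟩
    2 + (L (combine c (pos (inject₁ j) 1F)) + toℕ (combine c (inject₁ j)))
      ≡⟨ cong (2 +_) (label-odd c (inject₁ j)) ⟩
    2 + 2 * M                                        ∎

  vsum-first : ∀ (c : Fin m) → vsum G labelling (combine c (pos 0F 0F)) + n′ ≡ suc (2 * M)
  vsum-first c = begin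
    vsum G labelling (combine c (pos 0F 0F)) + n′
      ≡⟨ cong (_+ n′) (vsum-copies labelling _) ⟩
    L (combine c (pos 0F 0F)) + L (prev (combine c (pos 0F 0F))) + n′
      ≡⟨ cong (λ e → L (combine c (pos 0F 0F)) + L e + n′) (prev-first c) ⟩
    L (combine c (pos 0F 0F)) + L (combine c (pos (fromℕ n′) 1F)) + n′
      ≡⟨ cong (λ t → t + L (combine c (pos (fromℕ n′) 1F)) + n′) (trans (label-even c 0F) (cong suc (toℕ-combine c 0F))) ⟩
    suc (n * toℕ c + 0) + L (combine c (pos (fromℕ n′) 1F)) + n′
      ≡⟨ arith (n * toℕ c) _ n′ ⟩
    suc (L (combine c (pos (fromℕ n′) 1F)) + (n * toℕ c + n′))
      ≡⟨ cong (λ t → suc (L (combine c (pos (fromℕ n′) 1F)) + (n * toℕ c + t))) (toℕ-fromℕ n′) ⟨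
    suc (L (combine c (pos (fromℕ n′) 1F)) + (n * toℕ c + toℕ (fromℕ n′)))
      ≡⟨ cong (λ t → suc (L (combine c (pos (fromℕ n′) 1F)) + t)) (toℕ-combine c (fromℕ n′)) ⟨
    suc (L (combine c (pos (fromℕ n′) 1F)) + toℕ (combine c (fromℕ n′)))
      ≡⟨ cong suc (label-odd c (fromℕ n′)) ⟩
    suc (2 * M) ∎
    where
    arith : ∀ a l d → suc (a + 0) + l + d ≡ suc (l + (a + d))
    arith = solve-∀

  -- The first vertex of a copy has sum 2M + 2 − n, stated additively to avoid truncated subtraction.
  EvenColour : ℕ → Set
  EvenColour s = s ≡ 2 + 2 * M ⊎ s + n′ ≡ suc (2 * M)

  vsum-evenColour : ∀ (c : Fin m) (j : Fin n) → EvenColour (vsum G labelling (combine c (pos j 0F)))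
  vsum-evenColour c 0F      = inj₂ (vsum-first c)
  vsum-evenColour c (suc j) = inj₁ (vsum-even c j)

  evenColour≢oddColour : .{{_ : NonZero n′}} → ∀ {s t} → EvenColour s → t ≡ suc (2 * M) → s ≢ t
  evenColour≢oddColour (inj₁ refl) refl = 1+n≢n
  evenColour≢oddColour (inj₂ s+n′≡) refl refl =
    ≢-nonZero⁻¹ n′ (+-cancelˡ-≡ (suc (2 * M)) n′ 0 (trans s+n′≡ (sym (+-identityʳ _))))

  labelling-antimagic : .{{_ : NonZero n′}} → IsLocalAntimagic G labelling
  labelling-antimagic = antimagic-from-prev labelling (coordinates-elim (λ v → V (prev v) ≢ V v) prev≢)
    where
    V : Fin (m * (2 * n)) → ℕ
    V = vsum G labelling

    prev≢ : ∀ (c : Fin m) (j : Fin n) b → V (prev (combine c (pos j b))) ≢ V (combine c (pos j b))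
    prev≢ c j 1F = evenColour≢oddColour (subst EvenColour (cong V (sym (prev-odd c j))) (vsum-evenColour c j))
                                        (vsum-odd c j)
    prev≢ c 0F 0F = ≢-sym (evenColour≢oddColour (vsum-evenColour c 0F)
                                               (trans (cong V (prev-first c)) (vsum-odd c (fromℕ n′))))
    prev≢ c (suc j) 0F = ≢-sym (evenColour≢oddColour (vsum-evenColour c (suc j))
                                                    (trans (cong V (prev-even c j)) (vsum-odd c (inject₁ j))))

  palette : List ℕ
  palette = suc (2 * M) ∸ n′ ∷ suc (2 * M) ∷ 2 + 2 * M ∷ []

  evenColour∈palette : ∀ {s} → EvenColour s → s ∈ palette
  evenColour∈palette (inj₁ s≡)    = there (there (here s≡))
  evenColour∈palette (inj₂ s+n′≡) = here (trans (sym (m+n∸n≡m _ n′)) (cong (_∸ n′) s+n′≡))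

  numColors-labelling≤3 : numColors G labelling ≤ 3
  numColors-labelling≤3 = numColors≤ G labelling (coordinates-elim (λ u → vsum G labelling u ∈ palette) ∈palette)
    where
    ∈palette : ∀ (c : Fin m) (j : Fin n) b → vsum G labelling (combine c (pos j b)) ∈ palette
    ∈palette c j 0F = evenColour∈palette (vsum-evenColour c j)
    ∈palette c j 1F = there (here (vsum-odd c j))

corollary3p3 : (n m : ℕ) → 2 ≤ n → 1 ≤ m → ChiLa≡ (copies m (C (2 * n))) 3
corollary3p3 (suc (suc n₀)) (suc m₀) (s≤s (s≤s z≤n)) (s≤s z≤n) =
  (labelling , labelling-antimagic , ≤-antisym numColors-labelling≤3 (lower labelling labelling-antimagic)) ,
  lower
  where
  open EvenCycleLabelling (suc m₀) (suc n₀)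

  G : Graph
  G = copies (suc m₀) (C (2 * suc (suc n₀)))

  lower : ∀ f → IsLocalAntimagic G f → 3 ≤ numColors G f
  lower = antimagic⇒3≤numColors {n = suc n₀} 0F
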